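{- Let $\phi(x,y,u,v,\vec{z})$ be a first-order formula, $M$ a structure, and $s$ an assignment of the variables $\vec{z}$ into $M$. The following are equivalent: (1) $M\models_s\begin{pmatrix}\forall x & \exists y\\ \forall u & \exists v\end{pmatrix}\phi(x,y,u,v,\vec{z})$, i.e. there are functions $f,g:M\to M$ such that for all $a,b\in M$, $M$ satisfies $\phi$ under the assignment extending $s$ by $x\mapsto a$, $y\mapsto f(a)$, $u\mapsto b$, $v\mapsto g(b)$; (2) $M\models_{\{s\}}\forall x\exists y\forall u\exists v\,\big(v\ \bot_{u\vec{z}}\ x\wedge\phi(x,y,u,v,\vec{z})\big)$.
   Context: Team semantics: a team is a set of assignments from a common set of variables into $M$; $s(\vec{w})$ is the tuple of values. $M\models_X\psi$ for first-order $\psi$ iff every $s\in X$ satisfies $\psi$; $M\models_X\vec{y}\ \bot_{\vec{x}}\ \vec{z}$ iff for all $s,s'\in X$ with $s(\vec{x})=s'(\vec{x})$ there is $s''\in X$ with $s''(\vec{x})=s(\vec{x})$, $s''(\vec{y})=s(\vec{y})$, $s''(\vec{z})=s'(\vec{z})$; here $u\vec{z}$ is the tuple $u$ followed by $\vec{z}$. $M\models_X\alpha\wedge\beta$ iff both hold; $M\models_X\exists x\psi$ iff there is $F:X\to M$ with $M\models_{X[F/x]}\psi$, where $X[F/x]=\{s(F(s)/x):s\in X\}$; $M\models_X\forall x\psi$ iff $M\models_{X[M/x]}\psi$, where $X[M/x]=\{s(a/x):s\in X,a\in M\}$. -}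

module Defs where

open import Data.Nat using (ℕ)
open import Data.Vec using (Vec)
open import Data.Product using (Σ; Σ-syntax; _×_; _,_)
open import Relation.Binary.PropositionalEquality using (_≡_)

-- Assignments are represented as tuples of values of the variables in the
-- domain, built by pairing: the most recently quantified variable comes first.
Team : Set → Set₁
Team A = A → Set

module TeamSemantics (M : Set) where

  _[M] : {A : Set} → Team A → Team (M × A)
  (X [M]) (a , t) = X t

  _[_] : {A : Set} (X : Team A) → ((t : A) → X t → M) → Team (M × A)
  (X [ F ]) (b , t) = Σ[ p ∈ X t ] (F t p ≡ b)

  ⊨∀ : {A : Set} → (Team (M × A) → Set) → Team A → Set
  ⊨∀ ψ X = ψ (X [M])

  ⊨∃ : {A : Set} → (Team (M × A) → Set) → Team A → Set
  ⊨∃ {A} ψ X = Σ[ F ∈ ((t : A) → X t → M) ] ψ (X [ F ])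

  ⊨FO : {A : Set} → (A → Set) → Team A → Set
  ⊨FO ψ X = ∀ t → X t → ψ t

  -- M ⊨_X  y ⊥_x z  (conditional independence atom); xf, yf, zf give s(x), s(y), s(z)
  ⊨⊥ : {A B C D : Set} → (A → C) → (A → B) → (A → D) → Team A → Set
  ⊨⊥ {A} yf xf zf X =
    ∀ s s' → X s → X s' → xf s ≡ xf s' →
      Σ[ s'' ∈ A ] (X s'' × xf s'' ≡ xf s × yf s'' ≡ yf s × zf s'' ≡ zf s')

  _⊨∧_ : {A : Set} → (Team A → Set) → (Team A → Set) → Team A → Set
  (α ⊨∧ β) X = α X × β X

  ⟦_⟧ : {A : Set} → A → Team A
  ⟦ s ⟧ t = t ≡ s

  -- assignments over variables  v, u, y, x, z⃗  (n z-variables)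
  Asg : ℕ → Set
  Asg n = M × (M × (M × (M × Vec M n)))

  HenkinSat : {n : ℕ} → (M → M → M → M → Vec M n → Set) → Vec M n → Set
  HenkinSat φ s = Σ[ f ∈ (M → M) ] Σ[ g ∈ (M → M) ]
                    (∀ a b → φ a (f a) b (g b) s)

  TeamSat : {n : ℕ} → (M → M → M → M → Vec M n → Set) → Vec M n → Set
  TeamSat {n} φ s =
    ⊨∀ (⊨∃ (⊨∀ (⊨∃ {M × (M × (M × Vec M n))}
      (⊨⊥ (λ { (v , u , y , x , z) → v })
          (λ { (v , u , y , x , z) → (u , z) })
          (λ { (v , u , y , x , z) → x })
       ⊨∧
       ⊨FO (λ { (v , u , y , x , z) → φ x y u v z }))))) ⟦ s ⟧

-- Evaluating ∀x ∃y ∀u ∃v on {s} produces the graph of two Skolem functions,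
-- y = f x and v = h u x, over all x and u; conversely every such pair of
-- functions arises.  On this graph φ holds iff φ x (f x) u (h u x) holds for
-- all x, u, and v ⊥_{u z⃗} x holds iff h u x does not depend on x, i.e. iff
-- h u x = g u for some g.  So satisfying teams correspond to Skolem functions
-- f, g of the Henkin quantifier.
module Submission where

open import Defs
open import Data.Nat using (ℕ)
open import Data.Vec using (Vec)
open import Data.Product using (∃₂; _×_; _,_; proj₁; proj₂; swap)
open import Function.Bundles using (_⇔_; mk⇔; module Equivalence)
open import Function.Properties.Equivalence using () renaming (sym to ⇔-sym; trans to ⇔-trans)
open import Relation.Binary.PropositionalEquality using (_≡_; refl; sym; trans; subst)
open import Relation.Unary using (_⊆_; _≐_)

module TeamInvariance (M : Set) where
  open TeamSemantics M

  ⊨FO-⊆ : {A : Set} {ψ : A → Set} {X Y : Team A} → X ⊆ Y → ⊨FO ψ Y → ⊨FO ψ X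
  ⊨FO-⊆ X⊆Y ψY t Xt = ψY t (X⊆Y Xt)

  ⊨⊥-≐ : {A B C D : Set} {yf : A → C} {xf : A → B} {zf : A → D} {X Y : Team A} →
          X ≐ Y → ⊨⊥ yf xf zf X → ⊨⊥ yf xf zf Y
  ⊨⊥-≐ (X⊆Y , Y⊆X) ⊥X t t' Yt Yt' x≡x' with ⊥X t t' (Y⊆X Yt) (Y⊆X Yt') x≡x'
  ... | t'' , Xt'' , equalities = t'' , X⊆Y Xt'' , equalities

module _ {M : Set} {n : ℕ} (s : Vec M n) where
  open TeamSemantics M
  open TeamInvariance M

  Graph : (M → M) → (M → M → M) → Team (Asg n)
  Graph f h (v , u , y , x , z) = z ≡ s × y ≡ f x × v ≡ h u x

  Choice-y : Set
  Choice-y = (t : M × Vec M n) → (⟦ s ⟧ [M]) t → M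

  Choice-v : Choice-y → Set
  Choice-v F = (t : M × (M × (M × Vec M n))) → (((⟦ s ⟧ [M]) [ F ]) [M]) t → M

  quantifiedTeam : (F : Choice-y) → Choice-v F → Team (Asg n)
  quantifiedTeam F G = (((⟦ s ⟧ [M]) [ F ]) [M]) [ G ]

  skolem-y : Choice-y → M → M
  skolem-y F x = F (x , s) refl

  skolem-v : (F : Choice-y) → Choice-v F → M → M → M
  skolem-v F G u x = G (u , skolem-y F x , x , s) (refl , refl)

  choice-y : (M → M) → Choice-y
  choice-y f (x , _) _ = f x

  choice-v : {F : Choice-y} → (M → M → M) → Choice-v F
  choice-v h (u , _ , x , _) _ = h u x

  quantifiedTeam≐Graph : (F : Choice-y) (G : Choice-v F) →
                         quantifiedTeam F G ≐ Graph (skolem-y F) (skolem-v F G)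
  quantifiedTeam≐Graph F G = (λ { {_ , _ , _ , _ , _} ((refl , refl) , refl) → refl , refl , refl })
                           , (λ { {_ , _ , _ , _ , _} (refl , refl , refl) → (refl , refl) , refl })

  v-of : Asg n → M
  v-of (v , u , y , x , z) = v

  uz-of : Asg n → M × Vec M n
  uz-of (v , u , y , x , z) = u , z

  x-of : Asg n → M
  x-of (v , u , y , x , z) = x

  Graph-⊨⊥⇔ : (f : M → M) (h : M → M → M) →
               ⊨⊥ v-of uz-of x-of (Graph f h) ⇔ (∀ u x x' → h u x ≡ h u x')
  Graph-⊨⊥⇔ f h = mk⇔ ignores-x independent
    where
    ignores-x : ⊨⊥ v-of uz-of x-of (Graph f h) → ∀ u x x' → h u x ≡ h u x'
    ignores-x ⊥G u x x'
      with ⊥G (h u x , u , f x , x , s) (h u x' , u , f x' , x' , s)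
              (refl , refl , refl) (refl , refl , refl) refl
    ... | (v'' , .u , _ , .x' , .s) , (refl , _ , v''≡h) , refl , v''≡hux , refl =
      trans (sym v''≡hux) v''≡h

    independent : (∀ u x x' → h u x ≡ h u x') → ⊨⊥ v-of uz-of x-of (Graph f h)
    independent h-const (._ , u , ._ , x , ._) (._ , .u , ._ , x' , ._)
                (refl , refl , refl) (refl , refl , refl) refl =
      (h u x , u , f x' , x' , s) , (refl , refl , h-const u x x') , refl , refl , refl

  module _ (φ : M → M → M → M → Vec M n → Set) where

    φ-at : Asg n → Set
    φ-at (v , u , y , x , z) = φ x y u v z

    Graph-⊨FO⇔ : (f : M → M) (h : M → M → M) →
                  ⊨FO φ-at (Graph f h) ⇔ (∀ x u → φ x (f x) u (h u x) s)
    Graph-⊨FO⇔ f h = mk⇔ (λ φG x u → φG _ (refl , refl , refl))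
                         (λ { φfh (._ , u , ._ , x , ._) (refl , refl , refl) → φfh x u })

    UniformSkolem : (M → M) → (M → M → M) → Set
    UniformSkolem f h = (∀ u x x' → h u x ≡ h u x') × (∀ x u → φ x (f x) u (h u x) s)

    HenkinSat⇔UniformSkolem : HenkinSat φ s ⇔ ∃₂ UniformSkolem
    HenkinSat⇔UniformSkolem = mk⇔
      (λ { (f , g , φfg) → f , (λ u _ → g u) , (λ _ _ _ → refl) , φfg })
      -- M may be empty, so x is fixed to u itself rather than to a chosen point.
      (λ { (f , h , h-const , φfh) →
             f , (λ u → h u u) , λ x u → subst (λ v → φ x (f x) u v s) (h-const u x u) (φfh x u) })

    TeamSat⇔UniformSkolem : TeamSat φ s ⇔ ∃₂ UniformSkolem
    TeamSat⇔UniformSkolem = mk⇔ skolemise choose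
      where
      skolemise : TeamSat φ s → ∃₂ UniformSkolem
      skolemise (F , G , ⊥T , φT) =
        skolem-y F , skolem-v F G
        , Equivalence.to (Graph-⊨⊥⇔ (skolem-y F) (skolem-v F G)) (⊨⊥-≐ T≐G ⊥T)
        , Equivalence.to (Graph-⊨FO⇔ (skolem-y F) (skolem-v F G)) (⊨FO-⊆ (proj₂ T≐G) φT)
        where
        T≐G : quantifiedTeam F G ≐ Graph (skolem-y F) (skolem-v F G)
        T≐G = quantifiedTeam≐Graph F G

      choose : ∃₂ UniformSkolem → TeamSat φ s
      choose (f , h , h-const , φfh) =
        choice-y f , choice-v h
        , ⊨⊥-≐ (swap T≐G) (Equivalence.from (Graph-⊨⊥⇔ f h) h-const)
        , ⊨FO-⊆ (proj₁ T≐G) (Equivalence.from (Graph-⊨FO⇔ f h) φfh)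
        where
        T≐G : quantifiedTeam (choice-y f) (choice-v h) ≐ Graph f h
        T≐G = quantifiedTeam≐Graph (choice-y f) (choice-v h)

lemma16 : (M : Set) (n : ℕ) (φ : M → M → M → M → Vec M n → Set) (s : Vec M n) →
          TeamSemantics.HenkinSat M φ s ⇔ TeamSemantics.TeamSat M φ s
lemma16 M n φ s = ⇔-trans (HenkinSat⇔UniformSkolem s φ) (⇔-sym (TeamSat⇔UniformSkolem s φ))
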